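{- Consider the online general knapsack problem with reservation in which the reservation cost of an item is proportional to its size, with reservation factor $\alpha>0$. For every $\varepsilon>0$ there is a constant $c>1$ such that Algorithm A (described in the context, run with parameter $c$) is $(2+\varepsilon)$-competitive in the non-strict sense, i.e., there exists a constant $\beta>0$ such that for every request sequence $S$, \[{\rm gain}_{\mathtt{OPT}}(S)\le (2+\varepsilon)\cdot {\rm gain}_{\mathtt{A}}(S)+\beta.\]
   Context: Online general knapsack with reservation: the knapsack has capacity $1$. Items $x=(s_x,v_x)$ with size $0<s_x\le 1$ and value $v_x> 0$ arrive one by one. When an item arrives, an online algorithm must immediately and irrevocably either pack it, reject it, or reserve it. After the whole sequence has arrived, the algorithm may pack any subset of the reserved items that fits into the knapsack together with the already packed items (total size at most $1$). Every reserved item incurs a reservation cost, paid regardless of whether the item is finally packed; in this setting the cost of reserving $x$ is $\alpha\cdot s_x$. The gain of an algorithm on a sequence $S$ is the total value of packed items minus the total reservation costs; ${\rm gain}_{\mathtt{OPT}}(S)$ is the maximum total value of a subset of items of $S$ of total size at most $1$. Notation: the density of an item is $d(x)=v_x/s_x$; for a set $X$ of items, $s(X)=\sum_{x\in X}s_x$, $v(X)=\sum_{x\in X}v_x$. Algorithm A (parameter $c>1$): maintain a set $R_s$ of reserved items, initially empty, and a number $d_\delta$, initially $0$. For each arriving item $x_k$: (1) if $d(x_k)\le\alpha$, reject $x_k$; (2) else if $s(R_s)<1$, reserve $x_k$ and perform the update below; (3) else if $d(x_k)\ge c\cdot d_\delta$, reserve $x_k$ and perform the update below; (4) else reject $x_k$.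 Update: set $R_s:=R_s\cup\{x_k\}$; then repeatedly let $x_\delta$ be a least dense item of $R_s$ and, if $s(R_s\setminus\{x_\delta\})\ge 1$, remove $x_\delta$ from $R_s$, until $s(R_s\setminus\{x_\delta\})<1$; then set $d_\delta$ to the density of a least dense item in $R_s$. (Items removed from $R_s$ remain reserved.) The algorithm never packs an item before the end; after the last item, it packs a maximum-value subset of all reserved items with total size at most $1$.
   Formalization: The reservation factor α, the item sizes and values, and the accuracy ε are all rational. -}

module Defs where

open import Data.Rational using (ℚ; 0ℚ; 1ℚ; _+_; _*_; _-_; _÷_; _≤_; _<_; positive)
open import Data.Rational.Properties using (pos⇒nonZero)
open import Data.List using (List; []; _∷_; foldr; map; length; lookup; removeAt)
open import Data.List.Relation.Binary.Sublist.Propositional using (_⊆_)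
open import Data.Fin using (Fin)
open import Data.Product using (Σ; _×_; _,_)
open import Relation.Binary.PropositionalEquality using (_≡_)

record Item : Set where
  constructor item
  field
    size     : ℚ
    value    : ℚ
    size-pos : 0ℚ < size
    size-≤1  : size ≤ 1ℚ
    value-pos : 0ℚ < value
open Item public

density : Item → ℚ
density x = (value x ÷ size x) {{pos⇒nonZero (size x) {{positive (size-pos x)}}}}

sumℚ : List ℚ → ℚ
sumℚ = foldr _+_ 0ℚ

sizeOf : List Item → ℚ
sizeOf xs = sumℚ (map size xs)

valueOf : List Item → ℚ
valueOf xs = sumℚ (map value xs)

LeastAt : (R : List Item) → Fin (length R) → Set
LeastAt R i = ∀ j → density (lookup R i) ≤ density (lookup R j)

-- The removal loop of the update (nondeterministic in the choice among
-- several least dense items).  Upd R R' : starting from R the loop ends with R'.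
data Upd : List Item → List Item → Set where
  stop : ∀ {R} (i : Fin (length R)) → LeastAt R i →
         sizeOf (removeAt R i) < 1ℚ → Upd R R
  drop : ∀ {R R'} (i : Fin (length R)) → LeastAt R i →
         1ℚ ≤ sizeOf (removeAt R i) → Upd (removeAt R i) R' → Upd R R'

IsLeastDensity : List Item → ℚ → Set
IsLeastDensity R d = Σ (Fin (length R)) λ i → LeastAt R i × d ≡ density (lookup R i)

record State : Set where
  constructor st
  field
    Rs       : List Item
    dδ       : ℚ
    reserved : List Item
open State public

initial : State
initial = st [] 0ℚ []

Reserve : State → Item → State → Set
Reserve σ x σ' = Upd (x ∷ Rs σ) (Rs σ') × IsLeastDensity (Rs σ') (dδ σ')
                 × reserved σ' ≡ x ∷ reserved σ

data Step (α c : ℚ) : State → Item → State → Set where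
  rule1 : ∀ {σ x} → density x ≤ α → Step α c σ x σ
  rule2 : ∀ {σ x σ'} → α < density x → sizeOf (Rs σ) < 1ℚ →
          Reserve σ x σ' → Step α c σ x σ'
  rule3 : ∀ {σ x σ'} → α < density x → 1ℚ ≤ sizeOf (Rs σ) →
          c * dδ σ ≤ density x → Reserve σ x σ' → Step α c σ x σ'
  rule4 : ∀ {σ x} → α < density x → 1ℚ ≤ sizeOf (Rs σ) →
          density x < c * dδ σ → Step α c σ x σ

data Run (α c : ℚ) : State → List Item → State → Set where
  done : ∀ {σ} → Run α c σ [] σ
  next : ∀ {σ σ₁ σ₂ x xs} → Step α c σ x σ₁ → Run α c σ₁ xs σ₂ → Run α c σ (x ∷ xs) σ₂

IsMaxPacking : List Item → ℚ → Set
IsMaxPacking xs w =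
  (Σ (List Item) λ ys → (ys ⊆ xs) × (sizeOf ys ≤ 1ℚ) × (valueOf ys ≡ w))
  × (∀ ys → ys ⊆ xs → sizeOf ys ≤ 1ℚ → valueOf ys ≤ w)

gainA : (α : ℚ) → State → ℚ → ℚ
gainA α σ wA = wA - α * sizeOf (reserved σ)

{-# OPTIONS --safe #-}
module Submission where

-- For a threshold density θ let the excess of an item be (v − θ s)⁺.  A packing of size at most 1
-- is worth at most θ plus the excess of its items, so OPT ≤ θ + excess(S).  Call θ admissible if
-- θ ≥ α and, once s(R_s) ≥ 1, also θ ≥ c d_δ.  At every admissible θ the excess of all items seen
-- so far is already carried by R_s: rejected items have density at most θ, hence no excess, and
-- the update loop only discards least dense items, which are no denser than the survivor defining
-- d_δ.  If R_s never fills up, A packs all of R_s and OPT ≤ α + w_A.  Otherwise, at θ = c d_δ,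
-- both R_s without a least dense item and that item alone fit, so OPT ≤ 2c w_A and d_δ ≤ 2 w_A.
-- The reserved size grows by O(1) each time d_δ grows by a factor c, and between such times every
-- newly reserved item stays in R_s; K such rounds force d_δ ≥ α (1 + K/a)², so the reservation
-- cost α · O(K) is at most (ε/2) w_A up to an additive constant.

open import Defs
open import Algebra.Bundles using (CommutativeMonoid)
open import Data.Fin using (Fin; zero; suc)
open import Data.List using (List; []; _∷_; [_]; _++_; map; length; lookup; removeAt)
open import Data.List.Properties using (++-assoc; ++-identityʳ)
open import Data.List.Relation.Binary.Sublist.Propositional
  using (_⊆_; []; _∷_; _∷ʳ_; ⊆-refl; ⊆-trans; minimum; from∈)
open import Data.List.Relation.Unary.All as All using (All; []; _∷_)
open import Data.List.Relation.Unary.Any as Any using (Any)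
open import Data.List.Relation.Unary.Any.Properties using (lookup-index)
open import Data.List.Relation.Binary.Sublist.Propositional.Properties using (All-resp-⊆; Any-resp-⊆)
open import Data.List.Membership.Propositional using (_∈_)
open import Data.List.Membership.Propositional.Properties using (∈-lookup)
open import Data.Product using (Σ; _×_; _,_; proj₁; proj₂)
open import Data.Rational
  using (ℚ; 0ℚ; 1ℚ; ½; _+_; _*_; _-_; -_; _⊔_; 1/_; _≤_; _<_; _≤?_; _<?_; NonZero; positive; nonNegative; >-nonZero)
import Data.Rational.Properties as ℚₚ
open import Data.Rational.Solver using (module +-*-Solver)
open import Data.Sum using (_⊎_; inj₁; inj₂)
open import Relation.Binary.PropositionalEquality
  using (_≡_; refl; sym; trans; cong; subst; module ≡-Reasoning)
open import Relation.Nullary using (¬_; yes; no; contradiction)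

open import Algebra.Properties.CommutativeSemigroup
  (CommutativeMonoid.commutativeSemigroup ℚₚ.+-0-commutativeMonoid)
  using (x∙yz≈y∙xz; interchange)
open +-*-Solver using (solve; _:+_; _:*_; _:-_; _:=_; con)

0≤q-p⇒p≤q : ∀ {p q} → 0ℚ ≤ q - p → p ≤ q
0≤q-p⇒p≤q {p} {q} 0≤q-p = begin
  p           ≡⟨ sym (ℚₚ.+-identityˡ p) ⟩
  0ℚ + p      ≤⟨ ℚₚ.+-monoˡ-≤ p 0≤q-p ⟩
  q - p + p   ≡⟨ solve 2 (λ p q → q :- p :+ p := q) refl p q ⟩
  q           ∎
  where open ℚₚ.≤-Reasoning

p≤q⇒0≤q-p : ∀ {p q} → p ≤ q → 0ℚ ≤ q - p
p≤q⇒0≤q-p {p} {q} p≤q = begin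
  0ℚ     ≡⟨ sym (ℚₚ.+-inverseʳ p) ⟩
  p - p  ≤⟨ ℚₚ.+-monoˡ-≤ (- p) p≤q ⟩
  q - p  ∎
  where open ℚₚ.≤-Reasoning

nonNeg-gap⇒≤ : ∀ {p q r} → 0ℚ ≤ r → r ≡ q - p → p ≤ q
nonNeg-gap⇒≤ 0≤r r≡q-p = 0≤q-p⇒p≤q (subst (0ℚ ≤_) r≡q-p 0≤r)

<⇒≱ : ∀ {p q} → p < q → ¬ (q ≤ p)
<⇒≱ p<q q≤p = ℚₚ.<-irrefl refl (ℚₚ.<-≤-trans p<q q≤p)

+-nonNeg : ∀ {p q} → 0ℚ ≤ p → 0ℚ ≤ q → 0ℚ ≤ p + q
+-nonNeg = ℚₚ.+-mono-≤

p≤p+q : ∀ {p q} → 0ℚ ≤ q → p ≤ p + q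
p≤p+q {p} 0≤q = subst (_≤ p + _) (ℚₚ.+-identityʳ p) (ℚₚ.+-monoʳ-≤ p 0≤q)

*-nonNeg : ∀ {p q} → 0ℚ ≤ p → 0ℚ ≤ q → 0ℚ ≤ p * q
*-nonNeg {p} {q} 0≤p 0≤q =
  ℚₚ.nonNegative⁻¹ _ {{ℚₚ.nonNeg*nonNeg⇒nonNeg p {{nonNegative 0≤p}} q {{nonNegative 0≤q}}}}

*-pos : ∀ {p q} → 0ℚ < p → 0ℚ < q → 0ℚ < p * q
*-pos {p} {q} 0<p 0<q =
  ℚₚ.positive⁻¹ _ {{ℚₚ.pos*pos⇒pos p {{positive 0<p}} q {{positive 0<q}}}}

square-nonNeg : ∀ p → 0ℚ ≤ p * p
square-nonNeg p with ℚₚ.≤-total 0ℚ p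
... | inj₁ 0≤p = *-nonNeg 0≤p 0≤p
... | inj₂ p≤0 = subst (0ℚ ≤_) (solve 1 (λ p → (:- p) :* (:- p) := p :* p) refl p)
                       (*-nonNeg 0≤-p 0≤-p)
  where
  open +-*-Solver using (:-_)
  0≤-p : 0ℚ ≤ - p
  0≤-p = ℚₚ.neg-antimono-≤ p≤0

*-monoˡ-≤-nonNeg : ∀ {r p q} → 0ℚ ≤ r → p ≤ q → r * p ≤ r * q
*-monoˡ-≤-nonNeg {r} 0≤r = ℚₚ.*-monoˡ-≤-nonNeg r {{nonNegative 0≤r}}

*-monoʳ-≤-nonNeg : ∀ {r p q} → 0ℚ ≤ r → p ≤ q → p * r ≤ q * r
*-monoʳ-≤-nonNeg {r} 0≤r = ℚₚ.*-monoʳ-≤-nonNeg r {{nonNegative 0≤r}}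

2ℚ 3ℚ 4ℚ 9ℚ 12ℚ : ℚ
2ℚ  = 1ℚ + 1ℚ
3ℚ  = 2ℚ + 1ℚ
4ℚ  = 2ℚ + 2ℚ
9ℚ  = 3ℚ * 3ℚ
12ℚ = 3ℚ * 4ℚ

-- Identities involving ι = 1 / e are checked by the ring solver with e ι kept symbolic;
-- this lemma then removes the defect term.
inverse-defect : ∀ {e ι X Y} → e * ι ≡ 1ℚ → X + (e * ι - 1ℚ) * Y ≡ X
inverse-defect {e} {ι} {X} {Y} eι≡1 = begin
  X + (e * ι - 1ℚ) * Y  ≡⟨ cong (λ z → X + (z - 1ℚ) * Y) eι≡1 ⟩
  X + 0ℚ * Y            ≡⟨ cong (X +_) (ℚₚ.*-zeroˡ Y) ⟩
  X + 0ℚ                ≡⟨ ℚₚ.+-identityʳ X ⟩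
  X                     ∎
  where open ≡-Reasoning

-- AM-GM: the gap is e (t - q ι / 2)².
linear≤quadratic : ∀ {e ι} → e * ι ≡ 1ℚ → 0ℚ ≤ e → ∀ q t →
                   q * t ≤ e * (t * t) + ½ * ½ * (q * q) * ι
linear≤quadratic {e} {ι} eι≡1 0≤e q t =
  nonNeg-gap⇒≤ (*-nonNeg 0≤e (square-nonNeg (t - ½ * q * ι))) gap≡
  where
  open ≡-Reasoning
  gap≡ : e * ((t - ½ * q * ι) * (t - ½ * q * ι)) ≡ e * (t * t) + ½ * ½ * (q * q) * ι - q * t
  gap≡ = begin
    e * ((t - ½ * q * ι) * (t - ½ * q * ι))
      ≡⟨ solve 4 (λ e ι q t →
           e :* ((t :- con ½ :* q :* ι) :* (t :- con ½ :* q :* ι))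
           := e :* (t :* t) :+ con ½ :* con ½ :* (q :* q) :* ι :- q :* t
              :+ (e :* ι :- con 1ℚ) :* (con ½ :* con ½ :* (q :* q) :* ι :- q :* t))
         refl e ι q t ⟩
    e * (t * t) + ½ * ½ * (q * q) * ι - q * t + (e * ι - 1ℚ) * (½ * ½ * (q * q) * ι - q * t)
      ≡⟨ inverse-defect {e} {ι} eι≡1 ⟩
    e * (t * t) + ½ * ½ * (q * q) * ι - q * t  ∎

sumOver : (Item → ℚ) → List Item → ℚ
sumOver g xs = sumℚ (map g xs)

sumOver-∷ʳ : ∀ g xs x → sumOver g (xs ++ [ x ]) ≡ sumOver g xs + g x
sumOver-∷ʳ g [] x = ℚₚ.+-comm (g x) 0ℚ
sumOver-∷ʳ g (y ∷ xs) x =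
  trans (cong (g y +_) (sumOver-∷ʳ g xs x)) (sym (ℚₚ.+-assoc (g y) _ (g x)))

sumOver-removeAt : ∀ g (xs : List Item) i →
                   sumOver g xs ≡ g (lookup xs i) + sumOver g (removeAt xs i)
sumOver-removeAt g (x ∷ xs) zero = refl
sumOver-removeAt g (x ∷ xs) (suc i) =
  trans (cong (g x +_) (sumOver-removeAt g xs i)) (x∙yz≈y∙xz (g x) (g (lookup xs i)) _)

sumOver-+ : ∀ g h xs → sumOver (λ y → g y + h y) xs ≡ sumOver g xs + sumOver h xs
sumOver-+ g h [] = refl
sumOver-+ g h (x ∷ xs) =
  trans (cong (g x + h x +_) (sumOver-+ g h xs)) (interchange (g x) (h x) (sumOver g xs) (sumOver h xs))

sumOver-* : ∀ k g xs → sumOver (λ y → k * g y) xs ≡ k * sumOver g xs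
sumOver-* k g [] = sym (ℚₚ.*-zeroʳ k)
sumOver-* k g (x ∷ xs) =
  trans (cong (k * g x +_) (sumOver-* k g xs)) (sym (ℚₚ.*-distribˡ-+ k (g x) _))

sumOver-nonNeg : ∀ {g} → (∀ y → 0ℚ ≤ g y) → ∀ xs → 0ℚ ≤ sumOver g xs
sumOver-nonNeg 0≤g []       = ℚₚ.≤-refl
sumOver-nonNeg 0≤g (x ∷ xs) = +-nonNeg (0≤g x) (sumOver-nonNeg 0≤g xs)

sumOver-mono : ∀ {g h xs} → All (λ y → g y ≤ h y) xs → sumOver g xs ≤ sumOver h xs
sumOver-mono []         = ℚₚ.≤-refl
sumOver-mono (g≤h ∷ ps) = ℚₚ.+-mono-≤ g≤h (sumOver-mono ps)

sumOver-mono-⊆ : ∀ {g xs ys} → (∀ y → 0ℚ ≤ g y) → xs ⊆ ys → sumOver g xs ≤ sumOver g ys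
sumOver-mono-⊆ 0≤g [] = ℚₚ.≤-refl
sumOver-mono-⊆ {g} {xs} {y ∷ ys} 0≤g (.y ∷ʳ xs⊆ys) = begin
  sumOver g xs          ≡⟨ sym (ℚₚ.+-identityˡ _) ⟩
  0ℚ + sumOver g xs     ≤⟨ ℚₚ.+-mono-≤ (0≤g y) (sumOver-mono-⊆ 0≤g xs⊆ys) ⟩
  g y + sumOver g ys    ∎
  where open ℚₚ.≤-Reasoning
sumOver-mono-⊆ {g} {x ∷ _} 0≤g (refl ∷ xs⊆ys) = ℚₚ.+-monoʳ-≤ (g x) (sumOver-mono-⊆ 0≤g xs⊆ys)

size-nonNeg : ∀ y → 0ℚ ≤ size y
size-nonNeg y = ℚₚ.<⇒≤ (size-pos y)

value≡density*size : ∀ y → value y ≡ density y * size y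
value≡density*size y = sym (begin
  value y * 1/ size y * size y    ≡⟨ ℚₚ.*-assoc (value y) (1/ size y) (size y) ⟩
  value y * (1/ size y * size y)  ≡⟨ cong (value y *_) (ℚₚ.*-inverseˡ (size y)) ⟩
  value y * 1ℚ                    ≡⟨ ℚₚ.*-identityʳ (value y) ⟩
  value y                         ∎)
  where
  open ≡-Reasoning
  instance _ = ℚₚ.pos⇒nonZero (size y) {{positive (size-pos y)}}

density≤⇒value≤ : ∀ {θ} y → density y ≤ θ → value y ≤ θ * size y
density≤⇒value≤ y d≤θ =
  subst (_≤ _) (sym (value≡density*size y)) (*-monoʳ-≤-nonNeg (size-nonNeg y) d≤θ)

≤density⇒≤value : ∀ {θ} y → θ ≤ density y → θ * size y ≤ value y
≤density⇒≤value y θ≤d =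
  subst (_ ≤_) (sym (value≡density*size y)) (*-monoʳ-≤-nonNeg (size-nonNeg y) θ≤d)

-- Excess value over a threshold density

excess : ℚ → Item → ℚ
excess θ y = (value y - θ * size y) ⊔ 0ℚ

Excess : ℚ → List Item → ℚ
Excess θ = sumOver (excess θ)

excess-nonNeg : ∀ θ y → 0ℚ ≤ excess θ y
excess-nonNeg θ y = ℚₚ.p≤q⊔p (value y - θ * size y) 0ℚ

excess-light : ∀ {θ} y → density y ≤ θ → excess θ y ≤ 0ℚ
excess-light {θ} y d≤θ = ℚₚ.⊔-lub v-θs≤0 ℚₚ.≤-refl
  where
  v-θs≤0 : value y - θ * size y ≤ 0ℚ
  v-θs≤0 = subst (value y - θ * size y ≤_) (ℚₚ.+-inverseʳ (θ * size y))
                 (ℚₚ.+-monoˡ-≤ (- (θ * size y)) (density≤⇒value≤ y d≤θ))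

value≤threshold+excess : ∀ θ y → value y ≤ θ * size y + excess θ y
value≤threshold+excess θ y = begin
  value y                            ≡⟨ solve 2 (λ v t → v := t :+ (v :- t)) refl (value y) (θ * size y) ⟩
  θ * size y + (value y - θ * size y) ≤⟨ ℚₚ.+-monoʳ-≤ (θ * size y) (ℚₚ.p≤p⊔q _ 0ℚ) ⟩
  θ * size y + excess θ y            ∎
  where open ℚₚ.≤-Reasoning

Excess-∷ʳ-≤ : ∀ θ P R x → Excess θ P ≤ Excess θ R → Excess θ (P ++ [ x ]) ≤ Excess θ (x ∷ R)
Excess-∷ʳ-≤ θ P R x P≤R = begin
  Excess θ (P ++ [ x ])    ≡⟨ sumOver-∷ʳ (excess θ) P x ⟩
  Excess θ P + excess θ x  ≤⟨ ℚₚ.+-monoˡ-≤ (excess θ x) P≤R ⟩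
  Excess θ R + excess θ x  ≡⟨ ℚₚ.+-comm (Excess θ R) (excess θ x) ⟩
  Excess θ (x ∷ R)         ∎
  where open ℚₚ.≤-Reasoning

excess≤value : ∀ {θ} y → 0ℚ ≤ θ → excess θ y ≤ value y
excess≤value {θ} y 0≤θ = ℚₚ.⊔-lub v-θs≤v (ℚₚ.<⇒≤ (value-pos y))
  where
  open ℚₚ.≤-Reasoning
  v-θs≤v : value y - θ * size y ≤ value y
  v-θs≤v = begin
    value y - θ * size y  ≤⟨ ℚₚ.+-monoʳ-≤ (value y) (ℚₚ.neg-antimono-≤ (*-nonNeg 0≤θ (size-nonNeg y))) ⟩
    value y + 0ℚ          ≡⟨ ℚₚ.+-identityʳ (value y) ⟩
    value y               ∎

price+excess≤value : ∀ {D θ} y → D ≤ θ → D ≤ density y → D * size y + excess θ y ≤ value y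
price+excess≤value {D} {θ} y D≤θ D≤d = begin
  D * size y + excess θ y              ≤⟨ ℚₚ.+-monoʳ-≤ (D * size y) (ℚₚ.⊔-lub v-θs≤v-Ds 0≤v-Ds) ⟩
  D * size y + (value y - D * size y)  ≡⟨ solve 2 (λ p v → p :+ (v :- p) := v) refl (D * size y) (value y) ⟩
  value y                              ∎
  where
  open ℚₚ.≤-Reasoning
  v-θs≤v-Ds : value y - θ * size y ≤ value y - D * size y
  v-θs≤v-Ds = ℚₚ.+-monoʳ-≤ (value y) (ℚₚ.neg-antimono-≤ (*-monoʳ-≤-nonNeg (size-nonNeg y) D≤θ))
  0≤v-Ds : 0ℚ ≤ value y - D * size y
  0≤v-Ds = p≤q⇒0≤q-p (≤density⇒≤value y D≤d)

packing-value≤ : ∀ {θ} ys → 0ℚ ≤ θ → sizeOf ys ≤ 1ℚ → valueOf ys ≤ θ + Excess θ ys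
packing-value≤ {θ} ys 0≤θ fits = begin
  valueOf ys                                   ≤⟨ sumOver-mono (All.universal (value≤threshold+excess θ) ys) ⟩
  sumOver (λ y → θ * size y + excess θ y) ys  ≡⟨ sumOver-+ (λ y → θ * size y) (excess θ) ys ⟩
  sumOver (λ y → θ * size y) ys + Excess θ ys ≡⟨ cong (_+ Excess θ ys) (sumOver-* θ size ys) ⟩
  θ * sizeOf ys + Excess θ ys                 ≤⟨ ℚₚ.+-monoˡ-≤ (Excess θ ys) (*-monoˡ-≤-nonNeg 0≤θ fits) ⟩
  θ * 1ℚ + Excess θ ys                        ≡⟨ cong (_+ Excess θ ys) (ℚₚ.*-identityʳ θ) ⟩
  θ + Excess θ ys                             ∎
  where open ℚₚ.≤-Reasoning

price+Excess≤value : ∀ {D θ xs} → D ≤ θ → All (λ y → D ≤ density y) xs →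
                     D * sizeOf xs + Excess θ xs ≤ valueOf xs
price+Excess≤value {D} {θ} {xs} D≤θ D≤ds = begin
  D * sizeOf xs + Excess θ xs                   ≡⟨ cong (_+ Excess θ xs) (sym (sumOver-* D size xs)) ⟩
  sumOver (λ y → D * size y) xs + Excess θ xs  ≡⟨ sym (sumOver-+ (λ y → D * size y) (excess θ) xs) ⟩
  sumOver (λ y → D * size y + excess θ y) xs   ≤⟨ sumOver-mono (All.map (λ {y} → price+excess≤value y D≤θ) D≤ds) ⟩
  valueOf xs                                    ∎
  where open ℚₚ.≤-Reasoning

heavySize : ℚ → Item → ℚ
heavySize t y with t ≤? density y
... | yes _ = size y
... | no  _ = 0ℚ

HeavySize : ℚ → List Item → ℚ
HeavySize t = sumOver (heavySize t)

heavySize-nonNeg : ∀ t y → 0ℚ ≤ heavySize t y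
heavySize-nonNeg t y with t ≤? density y
... | yes _ = size-nonNeg y
... | no  _ = ℚₚ.≤-refl

heavySize≤size : ∀ t y → heavySize t y ≤ size y
heavySize≤size t y with t ≤? density y
... | yes _ = ℚₚ.≤-refl
... | no  _ = size-nonNeg y

heavySize-heavy : ∀ {t} y → t ≤ density y → heavySize t y ≡ size y
heavySize-heavy {t} y t≤d with t ≤? density y
... | yes _   = refl
... | no  t≰d = contradiction t≤d t≰d

heavySize-light : ∀ {t} y → density y < t → heavySize t y ≤ 0ℚ
heavySize-light {t} y d<t with t ≤? density y
... | yes t≤d = contradiction t≤d (<⇒≱ d<t)
... | no  _   = ℚₚ.≤-refl

HeavySize-nonNeg : ∀ t xs → 0ℚ ≤ HeavySize t xs
HeavySize-nonNeg t = sumOver-nonNeg (heavySize-nonNeg t)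

HeavySize≤sizeOf : ∀ t xs → HeavySize t xs ≤ sizeOf xs
HeavySize≤sizeOf t xs = sumOver-mono (All.universal (heavySize≤size t) xs)

-- Least dense items and the removal loop

removeAt-⊆ : ∀ {A : Set} (xs : List A) i → removeAt xs i ⊆ xs
removeAt-⊆ (x ∷ xs) zero    = x ∷ʳ ⊆-refl
removeAt-⊆ (x ∷ xs) (suc i) = refl ∷ removeAt-⊆ xs i

LeastAt⇒All : ∀ {R i} → LeastAt R i → All (λ z → density (lookup R i) ≤ density z) R
LeastAt⇒All least = All.tabulate λ z∈R →
  subst (λ z → _ ≤ density z) (sym (lookup-index z∈R)) (least (Any.index z∈R))

least≤all : ∀ {R d} → IsLeastDensity R d → All (λ z → d ≤ density z) R
least≤all (_ , least , refl) = LeastAt⇒All least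

least-satisfies : ∀ {R d} {P : ℚ → Set} → IsLeastDensity R d → All (λ z → P (density z)) R → P d
least-satisfies (i , _ , refl) all = All.lookup all (∈-lookup i)

least-witness : ∀ {R d θ} → IsLeastDensity R d → d ≤ θ → Any (λ z → density z ≤ θ) R
least-witness (i , _ , refl) d≤θ = Any.map (λ { refl → d≤θ }) (∈-lookup i)

Halts : List Item → Set
Halts R = Σ (Fin (length R)) λ i → LeastAt R i × sizeOf (removeAt R i) < 1ℚ

Halts⇒sizeOf<2 : ∀ R → Halts R → sizeOf R < 2ℚ
Halts⇒sizeOf<2 R (i , _ , rest<1) = begin-strict
  sizeOf R                                           ≡⟨ sumOver-removeAt size R i ⟩
  size (lookup R i) + sizeOf (removeAt R i)          <⟨ ℚₚ.+-mono-≤-< (size-≤1 (lookup R i)) rest<1 ⟩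
  2ℚ                                                 ∎
  where open ℚₚ.≤-Reasoning

Upd-⊆ : ∀ {R R'} → Upd R R' → R' ⊆ R
Upd-⊆ (stop _ _ _)         = ⊆-refl
Upd-⊆ {R} (drop i _ _ upd) = ⊆-trans (Upd-⊆ upd) (removeAt-⊆ R i)

Upd-halts : ∀ {R R'} → Upd R R' → Halts R'
Upd-halts (stop i least rest<1) = i , least , rest<1
Upd-halts (drop _ _ _ upd)      = Upd-halts upd

Upd-unchanged⊎full : ∀ {R R'} → Upd R R' → R' ≡ R ⊎ 1ℚ ≤ sizeOf R'
Upd-unchanged⊎full (stop _ _ _) = inj₁ refl
Upd-unchanged⊎full (drop _ _ full upd) with Upd-unchanged⊎full upd
... | inj₁ refl  = inj₂ full
... | inj₂ full' = inj₂ full'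

-- Every dropped item is a least dense one, hence no denser than any survivor.
Upd-sumOver-≤ : ∀ {g θ R R'} → (∀ y → density y ≤ θ → g y ≤ 0ℚ) → Upd R R' →
                Any (λ z → density z ≤ θ) R' → sumOver g R ≤ sumOver g R'
Upd-sumOver-≤ g≤0 (stop _ _ _) _ = ℚₚ.≤-refl
Upd-sumOver-≤ {g} {θ} {R} {R'} g≤0 (drop i least _ upd) light = begin
  sumOver g R                                  ≡⟨ sumOver-removeAt g R i ⟩
  g (lookup R i) + sumOver g (removeAt R i)    ≤⟨ ℚₚ.+-mono-≤ (g≤0 _ dropped-light) (Upd-sumOver-≤ g≤0 upd light) ⟩
  0ℚ + sumOver g R'                            ≡⟨ ℚₚ.+-identityˡ _ ⟩
  sumOver g R'                                 ∎
  where
  open ℚₚ.≤-Reasoning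
  light-in-R : Any (λ z → density z ≤ θ) R
  light-in-R = Any-resp-⊆ (⊆-trans (Upd-⊆ upd) (removeAt-⊆ R i)) light
  dropped-light : density (lookup R i) ≤ θ
  dropped-light = ℚₚ.≤-trans (least (Any.index light-in-R)) (lookup-index light-in-R)

Excess-removeAt-light : ∀ {θ} R i → density (lookup R i) ≤ θ → Excess θ R ≤ Excess θ (removeAt R i)
Excess-removeAt-light {θ} R i light = begin
  Excess θ R                                      ≡⟨ sumOver-removeAt (excess θ) R i ⟩
  excess θ (lookup R i) + Excess θ (removeAt R i) ≤⟨ ℚₚ.+-monoˡ-≤ _ (excess-light (lookup R i) light) ⟩
  0ℚ + Excess θ (removeAt R i)                    ≡⟨ ℚₚ.+-identityˡ _ ⟩
  Excess θ (removeAt R i)                         ∎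
  where open ℚₚ.≤-Reasoning

item≤maxPacking : ∀ {X w y} → IsMaxPacking X w → y ∈ X → value y ≤ w
item≤maxPacking {y = y} (_ , maximal) y∈X = subst (_≤ _) (ℚₚ.+-identityʳ (value y))
  (maximal [ y ] (from∈ y∈X) (subst (_≤ 1ℚ) (sym (ℚₚ.+-identityʳ (size y))) (size-≤1 y)))

-- Below, D and sx are the density and size of a least dense item of a full R_s, and sP and E
-- the size and excess of the rest of R_s, which fits into the knapsack.

cD+E≤2cw : ∀ {c D sx sP E w} → 1ℚ ≤ c → 0ℚ ≤ D → 0ℚ ≤ E → 1ℚ ≤ sx + sP →
           D * sx ≤ w → D * sP + E ≤ w → c * D + E ≤ 2ℚ * c * w
cD+E≤2cw {c} {D} {sx} {sP} {E} {w} 1≤c 0≤D 0≤E 1≤sx+sP x≤w rest≤w =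
  nonNeg-gap⇒≤ gap-nonNeg gap≡
  where
  0≤c : 0ℚ ≤ c
  0≤c = ℚₚ.≤-trans (ℚₚ.nonNegative⁻¹ 1ℚ) 1≤c
  gap-nonNeg : 0ℚ ≤ c * (w - D * sx) + c * (w - (D * sP + E)) + c * D * (sx + sP - 1ℚ) + (c - 1ℚ) * E
  gap-nonNeg = +-nonNeg (+-nonNeg (+-nonNeg
    (*-nonNeg 0≤c (p≤q⇒0≤q-p x≤w))
    (*-nonNeg 0≤c (p≤q⇒0≤q-p rest≤w)))
    (*-nonNeg (*-nonNeg 0≤c 0≤D) (p≤q⇒0≤q-p 1≤sx+sP)))
    (*-nonNeg (p≤q⇒0≤q-p 1≤c) 0≤E)
  gap≡ : c * (w - D * sx) + c * (w - (D * sP + E)) + c * D * (sx + sP - 1ℚ) + (c - 1ℚ) * E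
         ≡ 2ℚ * c * w - (c * D + E)
  gap≡ = solve 6 (λ c D sx sP E w →
      c :* (w :- D :* sx) :+ c :* (w :- (D :* sP :+ E)) :+ c :* D :* (sx :+ sP :- con 1ℚ) :+ (c :- con 1ℚ) :* E
      := con 2ℚ :* c :* w :- (c :* D :+ E)) refl c D sx sP E w

D≤2w : ∀ {D sx sP E w} → 0ℚ ≤ D → 0ℚ ≤ E → 1ℚ ≤ sx + sP →
       D * sx ≤ w → D * sP + E ≤ w → D ≤ 2ℚ * w
D≤2w {D} {E = E} {w} 0≤D 0≤E 1≤sx+sP x≤w rest≤w = begin
  D              ≡⟨ sym (ℚₚ.+-identityʳ D) ⟩
  D + 0ℚ         ≤⟨ ℚₚ.+-monoʳ-≤ D 0≤E ⟩
  D + E          ≡⟨ cong (_+ E) (sym (ℚₚ.*-identityˡ D)) ⟩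
  1ℚ * D + E     ≤⟨ cD+E≤2cw ℚₚ.≤-refl 0≤D 0≤E 1≤sx+sP x≤w rest≤w ⟩
  2ℚ * 1ℚ * w    ∎
  where open ℚₚ.≤-Reasoning

-- The invariant of Algorithm A

module Analysis (α c a : ℚ) (0<α : 0ℚ < α) (1≤c : 1ℚ ≤ c)
  (growth : ∀ K → 0ℚ ≤ K → (K + 1ℚ + a) * (K + 1ℚ + a) ≤ c * ((K + a) * (K + a)))
  where

  0≤c : 0ℚ ≤ c
  0≤c = ℚₚ.≤-trans (ℚₚ.nonNegative⁻¹ 1ℚ) 1≤c

  ≤c* : ∀ {d} → 0ℚ ≤ d → d ≤ c * d
  ≤c* {d} 0≤d = subst (_≤ c * d) (ℚₚ.*-identityˡ d) (*-monoʳ-≤-nonNeg 0≤d 1≤c)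

  Admissible : State → ℚ → Set
  Admissible σ θ = α ≤ θ × (1ℚ ≤ sizeOf (Rs σ) → c * dδ σ ≤ θ)

  NotFull : State → Set
  NotFull σ = sizeOf (Rs σ) < 1ℚ × sizeOf (reserved σ) ≤ sizeOf (Rs σ)

  -- K counts the times the threshold μ has been multiplied by c since R_s became full;
  -- the quadratic bound μ-large stands in for μ ≥ α c^K.  Items reserved since μ last
  -- grew are at least c μ dense and have never left R_s.
  record Full (σ : State) : Set where
    field
      full           : 1ℚ ≤ sizeOf (Rs σ)
      least          : IsLeastDensity (Rs σ) (dδ σ)
      halts          : Halts (Rs σ)
      K μ            : ℚ
      0≤K            : 0ℚ ≤ K
      μ-large        : α * ((K + a) * (K + a)) ≤ (a * a) * μ
      μ≤dδ           : μ ≤ dδ σ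
      reserved-small : sizeOf (reserved σ) ≤ HeavySize (c * μ) (Rs σ) + (2ℚ + 3ℚ * K)

  Full⇒reserved≤ : ∀ {σ} (F : Full σ) → sizeOf (reserved σ) ≤ 4ℚ + 3ℚ * Full.K F
  Full⇒reserved≤ {σ} F = begin
    sizeOf (reserved σ)                        ≤⟨ reserved-small ⟩
    HeavySize (c * μ) (Rs σ) + (2ℚ + 3ℚ * K)   ≤⟨ ℚₚ.+-monoˡ-≤ _ heavy≤2 ⟩
    2ℚ + (2ℚ + 3ℚ * K)                         ≡⟨ sym (ℚₚ.+-assoc 2ℚ 2ℚ (3ℚ * K)) ⟩
    4ℚ + 3ℚ * K                                ∎
    where
    open Full F
    open ℚₚ.≤-Reasoning
    heavy≤2 : HeavySize (c * μ) (Rs σ) ≤ 2ℚ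
    heavy≤2 = ℚₚ.≤-trans (HeavySize≤sizeOf (c * μ) (Rs σ)) (ℚₚ.<⇒≤ (Halts⇒sizeOf<2 (Rs σ) halts))

  -- P is the part of the request sequence processed so far.
  record Invariant (σ : State) (P : List Item) : Set where
    field
      dense       : All (λ y → α < density y) (Rs σ)
      Rs⊆reserved : Rs σ ⊆ reserved σ
      phase       : NotFull σ ⊎ Full σ
      captures    : ∀ θ → Admissible σ θ → Excess θ P ≤ Excess θ (Rs σ)

  initial-invariant : Invariant initial []
  initial-invariant = record
    { dense       = []
    ; Rs⊆reserved = []
    ; phase       = inj₁ (ℚₚ.positive⁻¹ 1ℚ , ℚₚ.≤-refl)
    ; captures    = λ _ _ → ℚₚ.≤-refl
    }

  α<least : ∀ {R d} → All (λ y → α < density y) R → IsLeastDensity R d → α < d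
  α<least dense least = least-satisfies least dense

  0≤least : ∀ {R d} → All (λ y → α < density y) R → IsLeastDensity R d → 0ℚ ≤ d
  0≤least dense least = ℚₚ.<⇒≤ (ℚₚ.<-trans 0<α (α<least dense least))

  reject : ∀ {σ P x} → Invariant σ P → (∀ θ → Admissible σ θ → density x ≤ θ) →
           Invariant σ (P ++ [ x ])
  reject {σ} {P} {x} I light = record
    { dense = dense ; Rs⊆reserved = Rs⊆reserved ; phase = phase ; captures = captures' }
    where
    open Invariant I
    open ℚₚ.≤-Reasoning
    captures' : ∀ θ → Admissible σ θ → Excess θ (P ++ [ x ]) ≤ Excess θ (Rs σ)
    captures' θ adm = begin
      Excess θ (P ++ [ x ])         ≤⟨ Excess-∷ʳ-≤ θ P (Rs σ) x (captures θ adm) ⟩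
      excess θ x + Excess θ (Rs σ)  ≤⟨ ℚₚ.+-monoˡ-≤ (Excess θ (Rs σ)) (excess-light x (light θ adm)) ⟩
      0ℚ + Excess θ (Rs σ)          ≡⟨ ℚₚ.+-identityˡ _ ⟩
      Excess θ (Rs σ)               ∎

  Upd-Excess-≤ : ∀ {R R' d θ} → Upd R R' → IsLeastDensity R' d → 0ℚ ≤ d →
                 (1ℚ ≤ sizeOf R' → c * d ≤ θ) → Excess θ R ≤ Excess θ R'
  Upd-Excess-≤ upd least 0≤d bound with Upd-unchanged⊎full upd
  ... | inj₁ refl = ℚₚ.≤-refl
  ... | inj₂ full = Upd-sumOver-≤ (λ y → excess-light y) upd
                      (least-witness least (ℚₚ.≤-trans (≤c* 0≤d) (bound full)))

  reserve : ∀ {σ P x σ'} → Invariant σ P → α < density x → Reserve σ x σ' →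
            (∀ θ → Admissible σ' θ → Admissible σ θ) → NotFull σ' ⊎ Full σ' →
            Invariant σ' (P ++ [ x ])
  reserve {σ} {P} {x} {σ'} I α<dx (upd , least' , reserved≡) adm phase' = record
    { dense       = dense'
    ; Rs⊆reserved = subst (Rs σ' ⊆_) (sym reserved≡) (⊆-trans (Upd-⊆ upd) (refl ∷ Rs⊆reserved))
    ; phase       = phase'
    ; captures    = λ θ adm' → ℚₚ.≤-trans (Excess-∷ʳ-≤ θ P (Rs σ) x (captures θ (adm θ adm')))
                      (Upd-Excess-≤ upd least' (0≤least dense' least') (proj₂ adm'))
    }
    where
    open Invariant I
    dense' : All (λ y → α < density y) (Rs σ')
    dense' = All-resp-⊆ (Upd-⊆ upd) (α<dx ∷ dense)

  module _ {σ P} (I : Invariant σ P) where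
    open Invariant I

    reserved≤Rs : sizeOf (Rs σ) < 1ℚ → sizeOf (reserved σ) ≤ sizeOf (Rs σ)
    reserved≤Rs small with phase
    ... | inj₁ notFull = proj₂ notFull
    ... | inj₂ F       = contradiction (Full.full F) (<⇒≱ small)

    full-phase : 1ℚ ≤ sizeOf (Rs σ) → Full σ
    full-phase full with phase
    ... | inj₁ notFull = contradiction full (<⇒≱ (proj₁ notFull))
    ... | inj₂ F       = F

  module Rule2 {σ P x σ'} (I : Invariant σ P) (small : sizeOf (Rs σ) < 1ℚ)
               (α<dx : α < density x) (res : Reserve σ x σ') where
    open Invariant I
    open ℚₚ.≤-Reasoning
    upd : Upd (x ∷ Rs σ) (Rs σ')
    upd = proj₁ res
    least' : IsLeastDensity (Rs σ') (dδ σ')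
    least' = proj₁ (proj₂ res)
    reserved≡ : reserved σ' ≡ x ∷ reserved σ
    reserved≡ = proj₂ (proj₂ res)

    α<dδ' : α < dδ σ'
    α<dδ' = α<least (All-resp-⊆ (Upd-⊆ upd) (α<dx ∷ dense)) least'

    reserved'≤ : sizeOf (reserved σ') ≤ size x + sizeOf (Rs σ)
    reserved'≤ = begin
      sizeOf (reserved σ')          ≡⟨ cong sizeOf reserved≡ ⟩
      size x + sizeOf (reserved σ)  ≤⟨ ℚₚ.+-monoʳ-≤ (size x) (reserved≤Rs I small) ⟩
      size x + sizeOf (Rs σ)        ∎

    first-full : 1ℚ ≤ sizeOf (Rs σ') → Full σ'
    first-full full' = record
      { full           = full'
      ; least          = least'
      ; halts          = Upd-halts upd
      ; K              = 0ℚ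
      ; μ              = dδ σ'
      ; 0≤K            = ℚₚ.≤-refl
      ; μ-large        = begin
          α * ((0ℚ + a) * (0ℚ + a))  ≡⟨ solve 2 (λ α a → α :* ((con 0ℚ :+ a) :* (con 0ℚ :+ a)) := (a :* a) :* α)
                                                refl α a ⟩
          (a * a) * α                ≤⟨ *-monoˡ-≤-nonNeg (square-nonNeg a) (ℚₚ.<⇒≤ α<dδ') ⟩
          (a * a) * dδ σ'            ∎
      ; μ≤dδ           = ℚₚ.≤-refl
      ; reserved-small = begin
          sizeOf (reserved σ')            ≤⟨ reserved'≤ ⟩
          size x + sizeOf (Rs σ)          ≤⟨ ℚₚ.+-mono-≤ (size-≤1 x) (ℚₚ.<⇒≤ small) ⟩
          2ℚ                              ≡⟨ sym (ℚₚ.+-identityˡ 2ℚ) ⟩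
          0ℚ + 2ℚ                         ≤⟨ ℚₚ.+-monoˡ-≤ 2ℚ (HeavySize-nonNeg (c * dδ σ') (Rs σ')) ⟩
          HeavySize (c * dδ σ') (Rs σ') + (2ℚ + 3ℚ * 0ℚ)  ∎
      }

    phase' : NotFull σ' ⊎ Full σ'
    phase' with sizeOf (Rs σ') <? 1ℚ | Upd-unchanged⊎full upd
    ... | yes small' | inj₁ Rs'≡ = inj₁ (small' , subst (sizeOf (reserved σ') ≤_) (cong sizeOf (sym Rs'≡)) reserved'≤)
    ... | yes small' | inj₂ full' = contradiction full' (<⇒≱ small')
    ... | no ¬small' | _          = inj₂ (first-full (ℚₚ.≮⇒≥ ¬small'))

  module Rule3 {σ P x σ'} (I : Invariant σ P) (full : 1ℚ ≤ sizeOf (Rs σ))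
               (cdδ≤dx : c * dδ σ ≤ density x) (res : Reserve σ x σ') where
    open Invariant I
    F : Full σ
    F = full-phase I full
    open Full F using (least; K; μ; 0≤K; μ-large; μ≤dδ; reserved-small)
    open ℚₚ.≤-Reasoning
    upd : Upd (x ∷ Rs σ) (Rs σ')
    upd = proj₁ res
    least' : IsLeastDensity (Rs σ') (dδ σ')
    least' = proj₁ (proj₂ res)
    reserved≡ : reserved σ' ≡ x ∷ reserved σ
    reserved≡ = proj₂ (proj₂ res)

    dδ≤dx : dδ σ ≤ density x
    dδ≤dx = ℚₚ.≤-trans (≤c* (0≤least dense least)) cdδ≤dx

    dδ-mono : dδ σ ≤ dδ σ'
    dδ-mono = least-satisfies least' (All-resp-⊆ (Upd-⊆ upd) (dδ≤dx ∷ least≤all least))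

    full' : 1ℚ ≤ sizeOf (Rs σ')
    full' with Upd-unchanged⊎full upd
    ... | inj₂ full' = full'
    ... | inj₁ Rs'≡  = begin
      1ℚ                   ≤⟨ full ⟩
      sizeOf (Rs σ)        ≡⟨ sym (ℚₚ.+-identityˡ _) ⟩
      0ℚ + sizeOf (Rs σ)   ≤⟨ ℚₚ.+-monoˡ-≤ (sizeOf (Rs σ)) (size-nonNeg x) ⟩
      sizeOf (x ∷ Rs σ)    ≡⟨ cong sizeOf (sym Rs'≡) ⟩
      sizeOf (Rs σ')       ∎

    admissible : ∀ θ → Admissible σ' θ → Admissible σ θ
    admissible θ (α≤θ , bound) = α≤θ , λ _ → ℚₚ.≤-trans (*-monoˡ-≤-nonNeg 0≤c dδ-mono) (bound full')

    next-phase : c * μ ≤ dδ σ' → Full σ'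
    next-phase cμ≤dδ' = record
      { full           = full'
      ; least          = least'
      ; halts          = Upd-halts upd
      ; K              = K + 1ℚ
      ; μ              = c * μ
      ; 0≤K            = +-nonNeg 0≤K (ℚₚ.nonNegative⁻¹ 1ℚ)
      ; μ-large        = begin
          α * ((K + 1ℚ + a) * (K + 1ℚ + a))  ≤⟨ *-monoˡ-≤-nonNeg (ℚₚ.<⇒≤ 0<α) (growth K 0≤K) ⟩
          α * (c * ((K + a) * (K + a)))      ≡⟨ solve 3 (λ α c q → α :* (c :* q) := c :* (α :* q)) refl α c _ ⟩
          c * (α * ((K + a) * (K + a)))      ≤⟨ *-monoˡ-≤-nonNeg 0≤c μ-large ⟩
          c * ((a * a) * μ)                  ≡⟨ solve 3 (λ c q μ → c :* (q :* μ) := q :* (c :* μ)) refl c (a * a) μ ⟩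
          (a * a) * (c * μ)                  ∎
      ; μ≤dδ           = cμ≤dδ'
      ; reserved-small = begin
          sizeOf (reserved σ')                                    ≡⟨ cong sizeOf reserved≡ ⟩
          size x + sizeOf (reserved σ)                            ≤⟨ ℚₚ.+-mono-≤ (size-≤1 x) (Full⇒reserved≤ F) ⟩
          1ℚ + (4ℚ + 3ℚ * K)                                      ≡⟨ solve 1 (λ K →
                                                                       con 1ℚ :+ (con 4ℚ :+ con 3ℚ :* K)
                                                                       := con 0ℚ :+ (con 2ℚ :+ con 3ℚ :* (K :+ con 1ℚ)))
                                                                     refl K ⟩
          0ℚ + (2ℚ + 3ℚ * (K + 1ℚ))                               ≤⟨ ℚₚ.+-monoˡ-≤ _ (HeavySize-nonNeg (c * (c * μ)) (Rs σ')) ⟩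
          HeavySize (c * (c * μ)) (Rs σ') + (2ℚ + 3ℚ * (K + 1ℚ))  ∎
      }

    same-phase : dδ σ' < c * μ → Full σ'
    same-phase dδ'<cμ = record
      { full           = full'
      ; least          = least'
      ; halts          = Upd-halts upd
      ; K              = K
      ; μ              = μ
      ; 0≤K            = 0≤K
      ; μ-large        = μ-large
      ; μ≤dδ           = ℚₚ.≤-trans μ≤dδ dδ-mono
      ; reserved-small = begin
          sizeOf (reserved σ')                                       ≡⟨ cong sizeOf reserved≡ ⟩
          size x + sizeOf (reserved σ)                               ≤⟨ ℚₚ.+-monoʳ-≤ (size x) reserved-small ⟩
          size x + (HeavySize (c * μ) (Rs σ) + (2ℚ + 3ℚ * K))        ≡⟨ sym (ℚₚ.+-assoc (size x) _ _) ⟩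
          size x + HeavySize (c * μ) (Rs σ) + (2ℚ + 3ℚ * K)          ≡⟨ cong (λ s → s + H + (2ℚ + 3ℚ * K)) (sym x-heavy) ⟩
          HeavySize (c * μ) (x ∷ Rs σ) + (2ℚ + 3ℚ * K)               ≤⟨ ℚₚ.+-monoˡ-≤ _ survivors ⟩
          HeavySize (c * μ) (Rs σ') + (2ℚ + 3ℚ * K)                  ∎
      }
      where
      H : ℚ
      H = HeavySize (c * μ) (Rs σ)
      x-heavy : heavySize (c * μ) x ≡ size x
      x-heavy = heavySize-heavy x (ℚₚ.≤-trans (*-monoˡ-≤-nonNeg 0≤c μ≤dδ) cdδ≤dx)
      survivors : HeavySize (c * μ) (x ∷ Rs σ) ≤ HeavySize (c * μ) (Rs σ')
      survivors = Upd-sumOver-≤ (λ y dy≤dδ' → heavySize-light y (ℚₚ.≤-<-trans dy≤dδ' dδ'<cμ))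
                                upd (least-witness least' ℚₚ.≤-refl)

    full-phase' : Full σ'
    full-phase' with c * μ ≤? dδ σ'
    ... | yes cμ≤dδ' = next-phase cμ≤dδ'
    ... | no  cμ≰dδ' = same-phase (ℚₚ.≰⇒> cμ≰dδ')

  step : ∀ {σ P x σ'} → Invariant σ P → Step α c σ x σ' → Invariant σ' (P ++ [ x ])
  step I (rule1 dx≤α) = reject I (λ θ adm → ℚₚ.≤-trans dx≤α (proj₁ adm))
  step I (rule4 _ full dx<cdδ) = reject I (λ θ adm → ℚₚ.<⇒≤ (ℚₚ.<-≤-trans dx<cdδ (proj₂ adm full)))
  step I (rule2 α<dx small res) =
    reserve I α<dx res (λ θ adm → proj₁ adm , λ full → contradiction full (<⇒≱ small))
            (Rule2.phase' I small α<dx res)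
  step I (rule3 α<dx full cdδ≤dx res) =
    reserve I α<dx res (Rule3.admissible I full cdδ≤dx res) (inj₂ (Rule3.full-phase' I full cdδ≤dx res))

  run : ∀ {σ P xs σ'} → Invariant σ P → Run α c σ xs σ' → Invariant σ' (P ++ xs)
  run {P = P} I done = subst (Invariant _) (sym (++-identityʳ P)) I
  run {P = P} I (next {x = x} {xs = xs} s r) =
    subst (Invariant _) (++-assoc P [ x ] xs) (run (step I s) r)

  data Outcome (σ : State) (wA wOPT : ℚ) : Set where
    unfilled : 0ℚ ≤ wA → wOPT ≤ α + wA → sizeOf (reserved σ) ≤ 1ℚ → Outcome σ wA wOPT
    filled   : (K : ℚ) → 0ℚ ≤ K → wOPT ≤ 2ℚ * c * wA →
              α * ((K + a) * (K + a)) ≤ (a * a) * (2ℚ * wA) →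
              sizeOf (reserved σ) ≤ 4ℚ + 3ℚ * K → Outcome σ wA wOPT

  module _ {S σ wA wOPT} (I : Invariant σ S)
           (maxA : IsMaxPacking (reserved σ) wA) (maxOPT : IsMaxPacking S wOPT) where
    open Invariant I
    open ℚₚ.≤-Reasoning

    packable : ∀ ys → ys ⊆ reserved σ → sizeOf ys ≤ 1ℚ → valueOf ys ≤ wA
    packable = proj₂ maxA

    opt≤ : ∀ θ → Admissible σ θ → wOPT ≤ θ + Excess θ (Rs σ)
    opt≤ θ adm with proj₁ maxOPT
    ... | ys , ys⊆S , fits , refl = begin
      valueOf ys           ≤⟨ packing-value≤ ys 0≤θ fits ⟩
      θ + Excess θ ys      ≤⟨ ℚₚ.+-monoʳ-≤ θ (sumOver-mono-⊆ (excess-nonNeg θ) ys⊆S) ⟩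
      θ + Excess θ S       ≤⟨ ℚₚ.+-monoʳ-≤ θ (captures θ adm) ⟩
      θ + Excess θ (Rs σ)  ∎
      where
      0≤θ : 0ℚ ≤ θ
      0≤θ = ℚₚ.≤-trans (ℚₚ.<⇒≤ 0<α) (proj₁ adm)

    notFull-outcome : NotFull σ → Outcome σ wA wOPT
    notFull-outcome (small , reserved≤Rs) = unfilled 0≤wA opt≤α+wA (ℚₚ.≤-trans reserved≤Rs (ℚₚ.<⇒≤ small))
      where
      0≤α : 0ℚ ≤ α
      0≤α = ℚₚ.<⇒≤ 0<α
      0≤wA : 0ℚ ≤ wA
      0≤wA = packable [] (minimum _) (ℚₚ.nonNegative⁻¹ 1ℚ)
      opt≤α+wA : wOPT ≤ α + wA
      opt≤α+wA = begin
        wOPT                 ≤⟨ opt≤ α (ℚₚ.≤-refl , λ full → contradiction full (<⇒≱ small)) ⟩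
        α + Excess α (Rs σ)  ≤⟨ ℚₚ.+-monoʳ-≤ α (sumOver-mono (All.universal (λ y → excess≤value y 0≤α) (Rs σ))) ⟩
        α + valueOf (Rs σ)   ≤⟨ ℚₚ.+-monoʳ-≤ α (packable (Rs σ) Rs⊆reserved (ℚₚ.<⇒≤ small)) ⟩
        α + wA               ∎

    full-outcome : Full σ → Outcome σ wA wOPT
    full-outcome F = filled K 0≤K opt≤2cwA
      (ℚₚ.≤-trans μ-large (*-monoˡ-≤-nonNeg (square-nonNeg a) (ℚₚ.≤-trans μ≤dδ dδ≤2wA)))
      (Full⇒reserved≤ F)
      where
      open Full F
      R Rest : List Item
      R = Rs σ
      Rest = removeAt R (proj₁ halts)
      xδ : Item
      xδ = lookup R (proj₁ halts)
      D θ : ℚ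
      D = dδ σ
      θ = c * D
      0≤D : 0ℚ ≤ D
      0≤D = 0≤least dense least
      D≤θ : D ≤ θ
      D≤θ = ≤c* 0≤D
      D≤all : All (λ z → D ≤ density z) R
      D≤all = least≤all least
      xδ∈R : xδ ∈ R
      xδ∈R = ∈-lookup (proj₁ halts)
      xδ≤D : density xδ ≤ D
      xδ≤D = least-satisfies {P = density xδ ≤_} least (LeastAt⇒All {R} (proj₁ (proj₂ halts)))
      split : 1ℚ ≤ size xδ + sizeOf Rest
      split = subst (1ℚ ≤_) (sumOver-removeAt size R (proj₁ halts)) full
      xδ-packed : D * size xδ ≤ wA
      xδ-packed = ℚₚ.≤-trans (≤density⇒≤value xδ (All.lookup D≤all xδ∈R))
                             (item≤maxPacking maxA (Any-resp-⊆ Rs⊆reserved xδ∈R))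
      Rest-packed : D * sizeOf Rest + Excess θ Rest ≤ wA
      Rest-packed = ℚₚ.≤-trans (price+Excess≤value D≤θ (All-resp-⊆ (removeAt-⊆ R _) D≤all))
        (packable Rest (⊆-trans (removeAt-⊆ R _) Rs⊆reserved) (ℚₚ.<⇒≤ (proj₂ (proj₂ halts))))
      opt≤2cwA : wOPT ≤ 2ℚ * c * wA
      opt≤2cwA = begin
        wOPT               ≤⟨ opt≤ θ (ℚₚ.≤-trans (ℚₚ.<⇒≤ (α<least dense least)) D≤θ , λ _ → ℚₚ.≤-refl) ⟩
        θ + Excess θ R     ≤⟨ ℚₚ.+-monoʳ-≤ θ (Excess-removeAt-light R _ (ℚₚ.≤-trans xδ≤D D≤θ)) ⟩
        θ + Excess θ Rest  ≤⟨ cD+E≤2cw 1≤c 0≤D (sumOver-nonNeg (excess-nonNeg θ) Rest)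
                                split xδ-packed Rest-packed ⟩
        2ℚ * c * wA        ∎
      dδ≤2wA : D ≤ 2ℚ * wA
      dδ≤2wA = D≤2w 0≤D (sumOver-nonNeg (excess-nonNeg θ) Rest) split xδ-packed Rest-packed

    invariant⇒outcome : Outcome σ wA wOPT
    invariant⇒outcome with phase
    ... | inj₁ notFull = notFull-outcome notFull
    ... | inj₂ F       = full-outcome F

  outcome : ∀ {S σ wA wOPT} → Run α c initial S σ → IsMaxPacking (reserved σ) wA →
            IsMaxPacking S wOPT → Outcome σ wA wOPT
  outcome r = invariant⇒outcome (run initial-invariant r)

-- Choice of the constants

module Constants (α ε : ℚ) (0<α : 0ℚ < α) (0<ε : 0ℚ < ε) where

  instance
    ε≢0 : NonZero ε
    ε≢0 = >-nonZero 0<ε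

  ι : ℚ
  ι = 1/ ε

  ει≡1 : ε * ι ≡ 1ℚ
  ει≡1 = ℚₚ.*-inverseʳ ε

  0≤ε : 0ℚ ≤ ε
  0≤ε = ℚₚ.<⇒≤ 0<ε

  0≤α : 0ℚ ≤ α
  0≤α = ℚₚ.<⇒≤ 0<α

  0≤ι : 0ℚ ≤ ι
  0≤ι = ℚₚ.<⇒≤ (ℚₚ.positive⁻¹ ι {{ℚₚ.1/pos⇒pos ε {{positive 0<ε}}}})

  c a M Z β : ℚ
  c = 1ℚ + ½ * ½ * ε
  a = 1ℚ + 12ℚ * ι
  M = 2ℚ + ε
  Z = 9ℚ * (M * M) * (a * a) * ι
  β = α * (4ℚ * M + Z)

  0<a : 0ℚ < a
  0<a = ℚₚ.<-≤-trans (ℚₚ.positive⁻¹ 1ℚ) (p≤p+q (*-nonNeg (ℚₚ.nonNegative⁻¹ 12ℚ) 0≤ι))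

  0<M : 0ℚ < M
  0<M = ℚₚ.<-≤-trans (ℚₚ.positive⁻¹ 2ℚ) (p≤p+q 0≤ε)

  0≤M : 0ℚ ≤ M
  0≤M = ℚₚ.<⇒≤ 0<M

  0≤Z : 0ℚ ≤ Z
  0≤Z = *-nonNeg (*-nonNeg (*-nonNeg (ℚₚ.nonNegative⁻¹ 9ℚ) (square-nonNeg M)) (square-nonNeg a)) 0≤ι

  1<c : 1ℚ < c
  1<c = subst (_< c) (ℚₚ.+-identityʳ 1ℚ) (ℚₚ.+-monoʳ-< 1ℚ (*-pos (ℚₚ.positive⁻¹ (½ * ½)) 0<ε))

  0<β : 0ℚ < β
  0<β = *-pos 0<α (ℚₚ.<-≤-trans (*-pos (ℚₚ.positive⁻¹ 4ℚ) 0<M) (p≤p+q 0≤Z))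

  -- With t = K + a ≥ 12 / ε, the gap c t² - (t + 1)² = t (ε t / 4 - 3) + (t - 1) is nonnegative.
  growth : ∀ K → 0ℚ ≤ K → (K + 1ℚ + a) * (K + 1ℚ + a) ≤ c * ((K + a) * (K + a))
  growth K 0≤K = nonNeg-gap⇒≤ gap-nonNeg gap≡
    where
    open ≡-Reasoning
    t : ℚ
    t = K + a
    gap-nonNeg : 0ℚ ≤ t * (½ * ½ * ε * (K + 1ℚ)) + (K + 12ℚ * ι)
    gap-nonNeg = +-nonNeg
      (*-nonNeg (+-nonNeg 0≤K (ℚₚ.<⇒≤ 0<a))
                (*-nonNeg (*-nonNeg (ℚₚ.nonNegative⁻¹ (½ * ½)) 0≤ε) (+-nonNeg 0≤K (ℚₚ.nonNegative⁻¹ 1ℚ))))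
      (+-nonNeg 0≤K (*-nonNeg (ℚₚ.nonNegative⁻¹ 12ℚ) 0≤ι))
    gap≡ : t * (½ * ½ * ε * (K + 1ℚ)) + (K + 12ℚ * ι) ≡ c * (t * t) - (K + 1ℚ + a) * (K + 1ℚ + a)
    gap≡ = begin
      t * (½ * ½ * ε * (K + 1ℚ)) + (K + 12ℚ * ι)
        ≡⟨ sym (inverse-defect {ε} {ι} ει≡1) ⟩
      t * (½ * ½ * ε * (K + 1ℚ)) + (K + 12ℚ * ι) + (ε * ι - 1ℚ) * (3ℚ * t)
        ≡⟨ solve 3 (λ K ε ι →
             (K :+ (con 1ℚ :+ con 12ℚ :* ι)) :* (con ½ :* con ½ :* ε :* (K :+ con 1ℚ)) :+ (K :+ con 12ℚ :* ι)
               :+ (ε :* ι :- con 1ℚ) :* (con 3ℚ :* (K :+ (con 1ℚ :+ con 12ℚ :* ι)))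
             := (con 1ℚ :+ con ½ :* con ½ :* ε) :* ((K :+ (con 1ℚ :+ con 12ℚ :* ι)) :* (K :+ (con 1ℚ :+ con 12ℚ :* ι)))
                :- (K :+ con 1ℚ :+ (con 1ℚ :+ con 12ℚ :* ι)) :* (K :+ con 1ℚ :+ (con 1ℚ :+ con 12ℚ :* ι)))
           refl K ε ι ⟩
      c * (t * t) - (K + 1ℚ + a) * (K + 1ℚ + a)  ∎

  unfilled-bound : ∀ {O W s} → 0ℚ ≤ W → O ≤ α + W → s ≤ 1ℚ → O ≤ M * (W - α * s) + β
  unfilled-bound {O} {W} {s} 0≤W O≤α+W s≤1 =
    ℚₚ.≤-trans O≤α+W (nonNeg-gap⇒≤ gap-nonNeg gap≡)
    where
    gap-nonNeg : 0ℚ ≤ (1ℚ + ε) * W + M * α * (1ℚ - s) + α * (1ℚ + ε + 2ℚ * M + Z)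
    gap-nonNeg = +-nonNeg (+-nonNeg
      (*-nonNeg (+-nonNeg (ℚₚ.nonNegative⁻¹ 1ℚ) 0≤ε) 0≤W)
      (*-nonNeg (*-nonNeg 0≤M 0≤α) (p≤q⇒0≤q-p s≤1)))
      (*-nonNeg 0≤α (+-nonNeg (+-nonNeg (+-nonNeg (ℚₚ.nonNegative⁻¹ 1ℚ) 0≤ε)
                                        (*-nonNeg (ℚₚ.nonNegative⁻¹ 2ℚ) 0≤M)) 0≤Z))
    gap≡ : (1ℚ + ε) * W + M * α * (1ℚ - s) + α * (1ℚ + ε + 2ℚ * M + Z) ≡ M * (W - α * s) + β - (α + W)
    gap≡ = solve 5 (λ ε W α s Z →
        (con 1ℚ :+ ε) :* W :+ (con 2ℚ :+ ε) :* α :* (con 1ℚ :- s)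
          :+ α :* (con 1ℚ :+ ε :+ con 2ℚ :* (con 2ℚ :+ ε) :+ Z)
        := (con 2ℚ :+ ε) :* (W :- α :* s) :+ α :* (con 4ℚ :* (con 2ℚ :+ ε) :+ Z) :- (α :+ W))
      refl ε W α s Z

  -- Multiplied by 4 a², this is AM-GM for t = K + a combined with α t² ≤ 2 a² W.
  linear-absorbed : ∀ {K W} → 0ℚ ≤ K → α * ((K + a) * (K + a)) ≤ (a * a) * (2ℚ * W) →
                    3ℚ * M * α * K ≤ ½ * ε * W + Z * α
  linear-absorbed {K} {W} 0≤K grown = ℚₚ.*-cancelˡ-≤-pos (4ℚ * (a * a)) {{positive 0<4a²}} (begin
    4ℚ * (a * a) * (3ℚ * M * α * K)
      ≡⟨ solve 4 (λ M α A K → con 4ℚ :* A :* (con 3ℚ :* M :* α :* K) := α :* (con 12ℚ :* M :* A :* K))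
           refl M α (a * a) K ⟩
    α * (q * K)                                 ≤⟨ *-monoˡ-≤-nonNeg 0≤α (*-monoˡ-≤-nonNeg 0≤q (p≤p+q (ℚₚ.<⇒≤ 0<a))) ⟩
    α * (q * t)                                 ≤⟨ *-monoˡ-≤-nonNeg 0≤α (linear≤quadratic ει≡1 0≤ε q t) ⟩
    α * (ε * (t * t) + ½ * ½ * (q * q) * ι)
      ≡⟨ solve 6 (λ α ε ι M A t →
           α :* (ε :* (t :* t) :+ con ½ :* con ½ :* ((con 12ℚ :* M :* A) :* (con 12ℚ :* M :* A)) :* ι)
           := ε :* (α :* (t :* t)) :+ con 4ℚ :* A :* (con 9ℚ :* (M :* M) :* A :* ι :* α))
           refl α ε ι M (a * a) t ⟩
    ε * (α * (t * t)) + 4ℚ * (a * a) * (Z * α)  ≤⟨ ℚₚ.+-monoˡ-≤ _ (*-monoˡ-≤-nonNeg 0≤ε grown) ⟩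
    ε * ((a * a) * (2ℚ * W)) + 4ℚ * (a * a) * (Z * α)
      ≡⟨ solve 5 (λ ε A W Z α →
           ε :* (A :* (con 2ℚ :* W)) :+ con 4ℚ :* A :* (Z :* α) := con 4ℚ :* A :* (con ½ :* ε :* W :+ Z :* α))
           refl ε (a * a) W Z α ⟩
    4ℚ * (a * a) * (½ * ε * W + Z * α)          ∎)
    where
    open ℚₚ.≤-Reasoning
    t q : ℚ
    t = K + a
    q = 12ℚ * M * (a * a)
    0≤q : 0ℚ ≤ q
    0≤q = *-nonNeg (*-nonNeg (ℚₚ.nonNegative⁻¹ 12ℚ) 0≤M) (square-nonNeg a)
    0<4a² : 0ℚ < 4ℚ * (a * a)
    0<4a² = *-pos (ℚₚ.positive⁻¹ 4ℚ) (*-pos 0<a 0<a)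

  filled-bound : ∀ {O W s K} → 0ℚ ≤ K → O ≤ 2ℚ * c * W →
                 α * ((K + a) * (K + a)) ≤ (a * a) * (2ℚ * W) → s ≤ 4ℚ + 3ℚ * K →
                 O ≤ M * (W - α * s) + β
  filled-bound {O} {W} {s} {K} 0≤K O≤2cW grown s≤ =
    ℚₚ.≤-trans O≤2cW (nonNeg-gap⇒≤ gap-nonNeg gap≡)
    where
    gap-nonNeg : 0ℚ ≤ (½ * ε * W + Z * α - 3ℚ * M * α * K) + M * α * (4ℚ + 3ℚ * K - s)
    gap-nonNeg = +-nonNeg (p≤q⇒0≤q-p (linear-absorbed 0≤K grown)) (*-nonNeg (*-nonNeg 0≤M 0≤α) (p≤q⇒0≤q-p s≤))
    gap≡ : (½ * ε * W + Z * α - 3ℚ * M * α * K) + M * α * (4ℚ + 3ℚ * K - s) ≡ M * (W - α * s) + β - 2ℚ * c * W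
    gap≡ = solve 6 (λ ε W α s K Z →
        (con ½ :* ε :* W :+ Z :* α :- con 3ℚ :* (con 2ℚ :+ ε) :* α :* K)
          :+ (con 2ℚ :+ ε) :* α :* (con 4ℚ :+ con 3ℚ :* K :- s)
        := (con 2ℚ :+ ε) :* (W :- α :* s) :+ α :* (con 4ℚ :* (con 2ℚ :+ ε) :+ Z)
           :- con 2ℚ :* (con 1ℚ :+ con ½ :* con ½ :* ε) :* W)
      refl ε W α s K Z

  open Analysis α c a 0<α (ℚₚ.<⇒≤ 1<c) growth using (Outcome; unfilled; filled; outcome)

  outcome⇒bound : ∀ {σ wA wOPT} → Outcome σ wA wOPT → wOPT ≤ M * (wA - α * sizeOf (reserved σ)) + β
  outcome⇒bound (unfilled 0≤wA opt≤ reserved≤)      = unfilled-bound 0≤wA opt≤ reserved≤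
  outcome⇒bound (filled K 0≤K opt≤ grown reserved≤) = filled-bound 0≤K opt≤ grown reserved≤

  competitive : ∀ (S : List Item) (σ : State) → Run α c initial S σ →
                ∀ wA → IsMaxPacking (reserved σ) wA →
                ∀ wOPT → IsMaxPacking S wOPT →
                wOPT ≤ (1ℚ + 1ℚ + ε) * gainA α σ wA + β
  competitive S σ run wA maxA wOPT maxOPT = outcome⇒bound (outcome run maxA maxOPT)

theorem1 : (α : ℚ) → 0ℚ < α → (ε : ℚ) → 0ℚ < ε →
    Σ ℚ λ c → 1ℚ < c × Σ ℚ λ β → 0ℚ < β ×
    (∀ (S : List Item) (σ : State) → Run α c initial S σ →
    ∀ wA → IsMaxPacking (reserved σ) wA →
    ∀ wOPT → IsMaxPacking S wOPT →
    wOPT ≤ (1ℚ + 1ℚ + ε) * gainA α σ wA + β)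
theorem1 α 0<α ε 0<ε = c , 1<c , β , 0<β , competitive
  where open Constants α ε 0<α 0<ε
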